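{- Let $G=(V,E)$ be a graph of maximum degree at most $3$ and let $(L,S,R)$ be a separation of $G$ (so $S$ separates $L$ and $R$). If there is a vertex $s\in S$ with exactly one neighbor $l$ in $L$, then there is a separation $(L',S',R')$ of $G$ such that $|S'|=|S|$ and $|L'|=|L|-1$.
   Context: A separation of a graph $G=(V,E)$ is a partition $(L,S,R)$ of $V$ such that no edge of $G$ has one endpoint in $L$ and the other in $R$; $S$ is then called a separator separating $L$ and $R$. -}

module Defs where

open import Data.Nat using (ℕ; _≤_)
open import Data.Bool using (Bool; true; false; _≟_)
open import Data.Fin using (Fin)
open import Data.Fin.Subset using (Subset; ∣_∣)
open import Data.Vec using (tabulate)
open import Relation.Binary.PropositionalEquality using (_≡_)
open import Relation.Nullary.Decidable using (⌊_⌋)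

record Graph (n : ℕ) : Set where
  field
    adj    : Fin n → Fin n → Bool
    sym    : ∀ u v → adj u v ≡ adj v u
    irrefl : ∀ v → adj v v ≡ false

open Graph public

N : ∀ {n} → Graph n → Fin n → Subset n
N G u = tabulate (adj G u)

degree : ∀ {n} → Graph n → Fin n → ℕ
degree G u = ∣ N G u ∣

MaxDegreeAtMost : ∀ {n} → Graph n → ℕ → Set
MaxDegreeAtMost G d = ∀ u → degree G u ≤ d

-- A partition (L,S,R) of V is given by assigning each vertex its part.
data Part : Set where
  inL inS inR : Part

isL isS isR : Part → Bool
isL inL = true
isL _   = false
isS inS = true
isS _   = false
isR inR = true
isR _   = false

Lset Sset Rset : ∀ {n} → (Fin n → Part) → Subset n
Lset p = tabulate (λ v → isL (p v))
Sset p = tabulate (λ v → isS (p v))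
Rset p = tabulate (λ v → isR (p v))

IsSeparation : ∀ {n} → Graph n → (Fin n → Part) → Set
IsSeparation G p = ∀ u v → p u ≡ inL → p v ≡ inR → adj G u v ≡ false

-- Move l from L into S and then s from S into R: S keeps its size and L loses l.
-- The result is still a separation, since L only shrank and the one vertex added
-- to R is s, whose only neighbour in L was l.
module Submission where

open import Defs hiding (sym)
open import Data.Nat using (ℕ; suc; _∸_)
open import Data.Nat.Properties using (suc-injective)
open import Data.Bool using (Bool; true; false)
open import Data.Bool.Properties using (¬-not)
open import Data.Fin using (Fin; zero; suc; _≟_)
open import Data.Fin.Subset using (Subset; ∣_∣)
open import Data.Fin.Properties using () renaming (suc-injective to suc-injectiveᶠ)
open import Data.Vec using (tabulate; _∷_)
open import Data.Vec.Properties using (tabulate-cong)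
open import Data.Vec.Functional using (updateAt)
open import Data.Vec.Functional.Properties using (updateAt-updates; updateAt-minimal)
open import Data.Product using (Σ; _×_; _,_)
open import Function using (const; _∘_; case_of_)
open import Relation.Nullary using (yes; no; contradiction)
open import Relation.Binary.PropositionalEquality
  using (_≡_; _≢_; refl; sym; trans; cong)

private
  variable
    n : ℕ

∣x∷q∣≡suc∣x∷p∣ : ∀ x {p q : Subset n} → ∣ q ∣ ≡ suc ∣ p ∣ → ∣ x ∷ q ∣ ≡ suc ∣ x ∷ p ∣
∣x∷q∣≡suc∣x∷p∣ true  eq = cong suc eq
∣x∷q∣≡suc∣x∷p∣ false eq = eq

∣tabulate∣-insert : (f g : Fin n → Bool) (a : Fin n) → (∀ v → v ≢ a → f v ≡ g v) →
  f a ≡ false → g a ≡ true → ∣ tabulate g ∣ ≡ suc ∣ tabulate f ∣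
∣tabulate∣-insert {suc n} f g zero agree fa ga rewrite fa | ga =
  cong suc (cong ∣_∣ (tabulate-cong (λ v → sym (agree (suc v) λ ()))))
∣tabulate∣-insert {suc n} f g (suc a) agree fa ga rewrite agree zero (λ ()) =
  ∣x∷q∣≡suc∣x∷p∣ (g zero) {tabulate (f ∘ suc)} {tabulate (g ∘ suc)}
    (∣tabulate∣-insert (f ∘ suc) (g ∘ suc) a agree′ fa ga)
  where
  agree′ : ∀ v → v ≢ a → f (suc v) ≡ g (suc v)
  agree′ v v≢a = agree (suc v) (v≢a ∘ suc-injectiveᶠ)

-- Opaque, so that p, a and x can be recovered from reassign p a x v by unification.
opaque
  reassign : (Fin n → Part) → Fin n → Part → Fin n → Part
  reassign p a x = updateAt p a (const x)

  reassign-here : ∀ {p a x} → reassign {n} p a x a ≡ x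
  reassign-here {p = p} {a} = updateAt-updates a p

  reassign-elsewhere : ∀ {p a x v} → v ≢ a → reassign {n} p a x v ≡ p v
  reassign-elsewhere {p = p} {a} {v = v} v≢a = updateAt-minimal v a p v≢a

reassign-reflects : ∀ {p a x v y} → x ≢ y → reassign {n} p a x v ≡ y → p v ≡ y
reassign-reflects {a = a} {v = v} x≢y eq with v ≟ a
... | yes refl = contradiction (trans (sym reassign-here) eq) x≢y
... | no v≢a   = trans (sym (reassign-elsewhere v≢a)) eq

module _ (isX : Part → Bool) (p : Fin n → Part) (a : Fin n) (x : Part) where

  private
    agree : ∀ v → v ≢ a → isX (p v) ≡ isX (reassign p a x v)
    agree v v≢a = cong isX (sym (reassign-elsewhere v≢a))

  ∣tabulate∣-reassign-enter : isX (p a) ≡ false → isX x ≡ true →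
    ∣ tabulate (isX ∘ reassign p a x) ∣ ≡ suc ∣ tabulate (isX ∘ p) ∣
  ∣tabulate∣-reassign-enter pa x∈ =
    ∣tabulate∣-insert (isX ∘ p) (isX ∘ reassign p a x) a agree pa
      (trans (cong isX reassign-here) x∈)

  ∣tabulate∣-reassign-leave : isX (p a) ≡ true → isX x ≡ false →
    ∣ tabulate (isX ∘ p) ∣ ≡ suc ∣ tabulate (isX ∘ reassign p a x) ∣
  ∣tabulate∣-reassign-leave pa x∉ =
    ∣tabulate∣-insert (isX ∘ reassign p a x) (isX ∘ p) a (λ v v≢a → sym (agree v v≢a))
      (trans (cong isX reassign-here) x∉) pa

  ∣tabulate∣-reassign-stay : isX (p a) ≡ isX x →
    ∣ tabulate (isX ∘ reassign p a x) ∣ ≡ ∣ tabulate (isX ∘ p) ∣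
  ∣tabulate∣-reassign-stay same = cong ∣_∣ (tabulate-cong agree′)
    where
    agree′ : ∀ v → isX (reassign p a x v) ≡ isX (p v)
    agree′ v with v ≟ a
    ... | yes refl = trans (cong isX reassign-here) (sym same)
    ... | no v≢a   = sym (agree v v≢a)

module _ (G : Graph n) {p : Fin n → Part} (sep : IsSeparation G p) where

  reassign-inS-isSeparation : ∀ a → IsSeparation G (reassign p a inS)
  reassign-inS-isSeparation a u v pu pv =
    sep u v (reassign-reflects (λ ()) pu) (reassign-reflects (λ ()) pv)

  reassign-inR-isSeparation : ∀ a → (∀ u → p u ≡ inL → adj G u a ≡ false) →
    IsSeparation G (reassign p a inR)
  reassign-inR-isSeparation a noLNeighbour u v pu pv with v ≟ a
  ... | yes refl = noLNeighbour u (reassign-reflects (λ ()) pu)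
  ... | no v≢a   = sep u v (reassign-reflects (λ ()) pu) (trans (sym (reassign-elsewhere v≢a)) pv)

mainTheorem3 : ∀ {n} (G : Graph n) → MaxDegreeAtMost G 3 →
    (p : Fin n → Part) → IsSeparation G p →
    (Σ (Fin n) λ s → p s ≡ inS × (Σ (Fin n) λ l → adj G s l ≡ true × p l ≡ inL ×
        (∀ v → adj G s v ≡ true → p v ≡ inL → v ≡ l))) →
    Σ (Fin n → Part) λ p′ → IsSeparation G p′ ×
      ∣ Sset p′ ∣ ≡ ∣ Sset p ∣ × ∣ Lset p′ ∣ ≡ ∣ Lset p ∣ ∸ 1
mainTheorem3 G _ p sep (s , ps , l , _ , pl , onlyLNeighbour) = p′ , sep′ , ∣S∣ , ∣L∣
  where
  q  = reassign p l inS
  p′ = reassign q s inR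

  s≢l : s ≢ l
  s≢l refl = case trans (sym ps) pl of λ ()

  qs : q s ≡ inS
  qs = trans (reassign-elsewhere s≢l) ps

  noLNeighbour : ∀ u → q u ≡ inL → adj G u s ≡ false
  noLNeighbour u qu = ¬-not λ us≡true →
    case onlyLNeighbour u (trans (Graph.sym G s u) us≡true) (reassign-reflects (λ ()) qu) of λ
      { refl → case trans (sym qu) reassign-here of λ () }

  sep′ : IsSeparation G p′
  sep′ = reassign-inR-isSeparation G (reassign-inS-isSeparation G sep l) s noLNeighbour

  ∣S∣ : ∣ Sset p′ ∣ ≡ ∣ Sset p ∣
  ∣S∣ = suc-injective (trans (sym (∣tabulate∣-reassign-leave isS q s inR (cong isS qs) refl))
                             (∣tabulate∣-reassign-enter isS p l inS (cong isS pl) refl))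

  ∣L∣ : ∣ Lset p′ ∣ ≡ ∣ Lset p ∣ ∸ 1
  ∣L∣ = trans (∣tabulate∣-reassign-stay isL q s inR (cong isL qs))
              (cong (_∸ 1) (sym (∣tabulate∣-reassign-leave isL p l inS (cong isL pl) refl)))
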